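{- Let $G$ be a finite graph such that $\max(\alpha_M(G),\omega_M(G))\geq 2$. Then $$p(G)\geq\lceil\log_2(\max(\alpha_M(G),\omega_M(G)))\rceil.$$
   Context: Graphs are finite, simple and undirected. For $W\subseteq V(G)$, $G[W]$ is the induced subgraph. A subset $M\subseteq V(G)$ is a module of $G$ if every $v\in V(G)\setminus M$ is adjacent either to all vertices of $M$ or to none of them; the modules $\emptyset$, $V(G)$ and the singletons are trivial. A graph $G$ is prime if $|V(G)|\geq 4$ and all its modules are trivial. An extension of $G$ is a graph $H$ with $V(H)\supseteq V(G)$ and $H[V(G)]=G$; a $p$-extension is an extension with $|V(H)\setminus V(G)|=p$. The prime bound $p(G)$ is the smallest integer $p\ge 0$ such that $G$ admits a prime $p$-extension (such extensions exist whenever $|V(G)|\ge 2$). The modular clique number $\omega_M(G)$ is the largest size of a module of $G$ that is a clique in $G$; the modular stability number $\alpha_M(G)$ is the largest size of a module of $G$ that is a stable set in $G$ (equivalently $\omega_M$ of the complement). -}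

module Defs where

open import Data.Nat using (ℕ; _+_; _≤_; _<_; _⊔_)
open import Data.Bool using (Bool; true; false)
open import Data.Fin using (Fin; _↑ˡ_)
open import Data.Fin.Subset using (Subset; _∈_; _∉_; ∣_∣; ⊥; ⊤)
open import Data.Product using (Σ; _×_; ∃)
open import Data.Sum using (_⊎_)
open import Relation.Nullary using (¬_)
open import Relation.Binary.PropositionalEquality using (_≡_; _≢_)

record Graph (n : ℕ) : Set where
  field
    adj     : Fin n → Fin n → Bool
    sym     : ∀ x y → adj x y ≡ adj y x
    irrefl  : ∀ x → adj x x ≡ false
open Graph public

IsModule : ∀ {n} → Graph n → Subset n → Set
IsModule G M = ∀ v → v ∉ M → ∀ x y → x ∈ M → y ∈ M → adj G v x ≡ adj G v y

IsTrivial : ∀ {n} → Subset n → Set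
IsTrivial M = (M ≡ ⊥) ⊎ (M ≡ ⊤) ⊎ (∣ M ∣ ≡ 1)

IsPrime : ∀ {n} → Graph n → Set
IsPrime {n} G = (4 ≤ n) × (∀ M → IsModule G M → IsTrivial M)

IsClique : ∀ {n} → Graph n → Subset n → Set
IsClique G M = ∀ x y → x ∈ M → y ∈ M → x ≢ y → adj G x y ≡ true

IsStable : ∀ {n} → Graph n → Subset n → Set
IsStable G M = ∀ x y → x ∈ M → y ∈ M → adj G x y ≡ false

IsExtension : ∀ {n p} → Graph n → Graph (n + p) → Set
IsExtension {n} {p} G H = ∀ x y → adj H (x ↑ˡ p) (y ↑ˡ p) ≡ adj G x y

HasPrimeExtension : ∀ {n} → Graph n → ℕ → Set
HasPrimeExtension {n} G p = Σ (Graph (n + p)) λ H → IsExtension G H × IsPrime H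

IsPrimeBound : ∀ {n} → Graph n → ℕ → Set
IsPrimeBound G p = HasPrimeExtension G p × (∀ q → q < p → ¬ HasPrimeExtension G q)

IsModCliqueNumber : ∀ {n} → Graph n → ℕ → Set
IsModCliqueNumber G k =
  (∃ λ M → IsModule G M × IsClique G M × ∣ M ∣ ≡ k)
  × (∀ M → IsModule G M → IsClique G M → ∣ M ∣ ≤ k)

IsModStabilityNumber : ∀ {n} → Graph n → ℕ → Set
IsModStabilityNumber G k =
  (∃ λ M → IsModule G M × IsStable G M × ∣ M ∣ ≡ k)
  × (∀ M → IsModule G M → IsStable G M → ∣ M ∣ ≤ k)

module Submission where

-- Let H be a prime p-extension of G and let M be a module of G that
-- is a clique or a stable set.  Two distinct x, y ∈ M are "twins" in G:
-- every other vertex of G sees both or neither (inside M by homogeneity,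
-- outside M because M is a module).  If x and y also had the same
-- neighbourhood among the p new vertices of H, they would be twins in H,
-- i.e. {x, y} would be a nontrivial module of the prime graph H.  Hence the
-- trace u ↦ (adj H w u)_{w new} is injective on M, and |M| ≤ 2^p.
-- Applying this to a largest stable and a largest clique module gives
-- α_M(G) ⊔ ω_M(G) ≤ 2^p(G), and taking ⌈log₂⌉ yields the theorem.

open import Defs
open import Data.Nat using (ℕ; _≤_; _⊔_)
open import Data.Nat.Logarithm using (⌈log₂_⌉)

open import Data.Nat using (zero; suc; _+_; _^_; _<_; z≤n; s≤s)
open import Data.Nat.Properties
  using (≤-trans; ≤-reflexive; +-mono-≤; +-suc; n≤1+n; ⊔-lub; <-irrefl; +-identityʳ; module ≤-Reasoning)
open import Data.Nat.Logarithm using (⌈log₂⌉-mono-≤; ⌈log₂2^n⌉≡n)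
open import Data.Bool using (Bool; true; false)
open import Data.Fin using (Fin; _↑ˡ_; _↑ʳ_; splitAt) renaming (zero to fzero; suc to fsuc)
open import Data.Fin.Properties using (_≟_; suc-injective; ↑ˡ-injective; splitAt⁻¹-↑ˡ; splitAt⁻¹-↑ʳ)
open import Data.Fin.Subset using (Subset; _∈_; _∉_; ∣_∣; ⊥; _∩_; _∪_; ∁; ⁅_⁆; _⊆_; _⊂_; inside; outside)
open import Data.Fin.Subset.Properties
  using (Empty-unique; ∣⊥∣≡0; ∣⊤∣≡n; ∣⁅x⁆∣≡1; x∈⁅x⁆; x∈⁅y⁆⇒x≡y; x≢y⇒x∉⁅y⁆; x∈p∪q⁻; x∈p∪q⁺; x∈p∩q⁻; x∈∁p⇒x∉p; p⊂q⇒∣p∣<∣q∣; _∈?_; ∉⊥)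
open import Data.Vec using (_∷_; []; tabulate; here; there)
open import Data.Vec.Properties using ([]=⇒lookup; lookup⇒[]=; lookup∘tabulate)
open import Data.Product using (_,_; proj₁; proj₂)
open import Data.Sum using (_⊎_; inj₁; inj₂)
open import Data.Empty using (⊥-elim)
open import Relation.Nullary using (¬_; yes; no)
open import Relation.Binary.PropositionalEquality
  using (_≡_; _≢_; refl; trans; cong; cong₂; subst; module ≡-Reasoning)
  renaming (sym to ≡-sym)

∣p∣≡∣p∩q∣+∣p∩∁q∣ : ∀ {n} (p q : Subset n) → ∣ p ∣ ≡ ∣ p ∩ q ∣ + ∣ p ∩ ∁ q ∣
∣p∣≡∣p∩q∣+∣p∩∁q∣ []            []            = refl
∣p∣≡∣p∩q∣+∣p∩∁q∣ (outside ∷ p) (outside ∷ q) = ∣p∣≡∣p∩q∣+∣p∩∁q∣ p q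
∣p∣≡∣p∩q∣+∣p∩∁q∣ (outside ∷ p) (inside  ∷ q) = ∣p∣≡∣p∩q∣+∣p∩∁q∣ p q
∣p∣≡∣p∩q∣+∣p∩∁q∣ (inside  ∷ p) (inside  ∷ q) = cong suc (∣p∣≡∣p∩q∣+∣p∩∁q∣ p q)
∣p∣≡∣p∩q∣+∣p∩∁q∣ (inside  ∷ p) (outside ∷ q) =
  trans (cong suc (∣p∣≡∣p∩q∣+∣p∩∁q∣ p q)) (≡-sym (+-suc ∣ p ∩ q ∣ ∣ p ∩ ∁ q ∣))

∣p∪q∣≤∣p∣+∣q∣ : ∀ {n} (p q : Subset n) → ∣ p ∪ q ∣ ≤ ∣ p ∣ + ∣ q ∣
∣p∪q∣≤∣p∣+∣q∣ []            []            = z≤n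
∣p∪q∣≤∣p∣+∣q∣ (outside ∷ p) (outside ∷ q) = ∣p∪q∣≤∣p∣+∣q∣ p q
∣p∪q∣≤∣p∣+∣q∣ (inside  ∷ p) (outside ∷ q) = s≤s (∣p∪q∣≤∣p∣+∣q∣ p q)
∣p∪q∣≤∣p∣+∣q∣ (outside ∷ p) (inside  ∷ q) =
  subst (suc ∣ p ∪ q ∣ ≤_) (≡-sym (+-suc ∣ p ∣ ∣ q ∣)) (s≤s (∣p∪q∣≤∣p∣+∣q∣ p q))
∣p∪q∣≤∣p∣+∣q∣ (inside  ∷ p) (inside  ∷ q) =
  s≤s (≤-trans (∣p∪q∣≤∣p∣+∣q∣ p q) (≤-trans (n≤1+n _) (≤-reflexive (≡-sym (+-suc ∣ p ∣ ∣ q ∣)))))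

Separates : ∀ {m n} → (Fin m → Fin n → Bool) → Subset n → Set
Separates f S = ∀ x y → x ∈ S → y ∈ S → (∀ j → f j x ≡ f j y) → x ≡ y

subsingleton-≤1 : ∀ {n} (S : Subset n) → (∀ x y → x ∈ S → y ∈ S → x ≡ y) → ∣ S ∣ ≤ 1
subsingleton-≤1 []            _   = z≤n
subsingleton-≤1 (outside ∷ S) sub =
  subsingleton-≤1 S (λ x y x∈S y∈S → suc-injective (sub (fsuc x) (fsuc y) (there x∈S) (there y∈S)))
subsingleton-≤1 {suc n} (inside ∷ S) sub = s≤s (≤-reflexive (trans (cong ∣_∣ S≡⊥) (∣⊥∣≡0 n)))
  where
  S≡⊥ : S ≡ ⊥
  S≡⊥ = Empty-unique λ { (y , y∈S) → 0≢suc (sub fzero (fsuc y) here (there y∈S)) }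
    where
    0≢suc : ∀ {y : Fin n} → fzero ≢ fsuc y
    0≢suc ()

∈-tabulate⁻ : ∀ {n} (g : Fin n → Bool) x → x ∈ tabulate g → g x ≡ true
∈-tabulate⁻ g x x∈ = trans (≡-sym (lookup∘tabulate g x)) ([]=⇒lookup x∈)

∉-tabulate⁻ : ∀ {n} (g : Fin n → Bool) x → x ∉ tabulate g → g x ≡ false
∉-tabulate⁻ g x x∉ with g x in gx
... | true  = ⊥-elim (x∉ (lookup⇒[]= x (tabulate g) (trans (lookup∘tabulate g x) gx)))
... | false = refl

separates-tail : ∀ {m n} (f : Fin (suc m) → Fin n → Bool) {S S′ : Subset n} →
  Separates f S → S′ ⊆ S → (∀ x y → x ∈ S′ → y ∈ S′ → f fzero x ≡ f fzero y) →
  Separates (λ j → f (fsuc j)) S′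
separates-tail f sep S′⊆S const x y x∈ y∈ agree =
  sep x y (S′⊆S x∈) (S′⊆S y∈) λ { fzero → const x y x∈ y∈ ; (fsuc j) → agree j }

separated-≤2^ : ∀ {n} m (f : Fin m → Fin n → Bool) (S : Subset n) → Separates f S → ∣ S ∣ ≤ 2 ^ m
separated-≤2^ zero    f S sep = subsingleton-≤1 S (λ x y x∈ y∈ → sep x y x∈ y∈ (λ ()))
separated-≤2^ (suc m) f S sep = begin
  ∣ S ∣                          ≡⟨ ∣p∣≡∣p∩q∣+∣p∩∁q∣ S T ⟩
  ∣ S ∩ T ∣ + ∣ S ∩ ∁ T ∣        ≤⟨ +-mono-≤ (separated-≤2^ m tail (S ∩ T) sepT) (separated-≤2^ m tail (S ∩ ∁ T) sep∁T) ⟩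
  2 ^ m + 2 ^ m                  ≡⟨ cong (2 ^ m +_) (≡-sym (+-identityʳ (2 ^ m))) ⟩
  2 ^ suc m                      ∎
  where
  open ≤-Reasoning
  T = tabulate (f fzero)
  tail = λ j → f (fsuc j)
  sepT : Separates tail (S ∩ T)
  sepT = separates-tail f sep (λ x∈ → proj₁ (x∈p∩q⁻ S T x∈)) λ x y x∈ y∈ →
    trans (∈-tabulate⁻ (f fzero) x (proj₂ (x∈p∩q⁻ S T x∈)))
          (≡-sym (∈-tabulate⁻ (f fzero) y (proj₂ (x∈p∩q⁻ S T y∈))))
  sep∁T : Separates tail (S ∩ ∁ T)
  sep∁T = separates-tail f sep (λ x∈ → proj₁ (x∈p∩q⁻ S (∁ T) x∈)) λ x y x∈ y∈ →
    trans (∉-tabulate⁻ (f fzero) x (x∈∁p⇒x∉p (proj₂ (x∈p∩q⁻ S (∁ T) x∈))))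
          (≡-sym (∉-tabulate⁻ (f fzero) y (x∈∁p⇒x∉p (proj₂ (x∈p∩q⁻ S (∁ T) y∈)))))

AreTwins : ∀ {n} → Graph n → Fin n → Fin n → Set
AreTwins G x y = ∀ v → v ≢ x → v ≢ y → adj G v x ≡ adj G v y

pair : ∀ {n} → Fin n → Fin n → Subset n
pair x y = ⁅ x ⁆ ∪ ⁅ y ⁆

∈-pair⁻ : ∀ {n} {x y a : Fin n} → a ∈ pair x y → a ≡ x ⊎ a ≡ y
∈-pair⁻ {x = x} {y} a∈ with x∈p∪q⁻ ⁅ x ⁆ ⁅ y ⁆ a∈
... | inj₁ a∈x = inj₁ (x∈⁅y⁆⇒x≡y x a∈x)
... | inj₂ a∈y = inj₂ (x∈⁅y⁆⇒x≡y y a∈y)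

x∈pair : ∀ {n} (x y : Fin n) → x ∈ pair x y
x∈pair x y = x∈p∪q⁺ (inj₁ (x∈⁅x⁆ x))

y∈pair : ∀ {n} (x y : Fin n) → y ∈ pair x y
y∈pair x y = x∈p∪q⁺ (inj₂ (x∈⁅x⁆ y))

twins⇒module : ∀ {n} (G : Graph n) {x y} → AreTwins G x y → IsModule G (pair x y)
twins⇒module G {x} {y} twins v v∉ a c a∈ c∈ with ∈-pair⁻ a∈ | ∈-pair⁻ c∈
... | inj₁ refl | inj₁ refl = refl
... | inj₂ refl | inj₂ refl = refl
... | inj₁ refl | inj₂ refl = twins v (λ { refl → v∉ (x∈pair x y) }) (λ { refl → v∉ (y∈pair x y) })
... | inj₂ refl | inj₁ refl = ≡-sym (twins v (λ { refl → v∉ (x∈pair x y) }) (λ { refl → v∉ (y∈pair x y) }))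

pair-nontrivial : ∀ {n} {x y : Fin n} → 4 ≤ n → x ≢ y → ¬ IsTrivial (pair x y)
pair-nontrivial {x = x} {y} _ _ (inj₁ empty) = ∉⊥ (subst (x ∈_) empty (x∈pair x y))
pair-nontrivial {n} {x} {y} 4≤n _ (inj₂ (inj₁ full)) = <-irrefl refl (begin-strict
  3          <⟨ 4≤n ⟩
  n          ≡⟨ ≡-sym (trans (cong ∣_∣ full) (∣⊤∣≡n n)) ⟩
  ∣ pair x y ∣  ≤⟨ ∣p∪q∣≤∣p∣+∣q∣ ⁅ x ⁆ ⁅ y ⁆ ⟩
  ∣ ⁅ x ⁆ ∣ + ∣ ⁅ y ⁆ ∣ ≡⟨ cong₂ _+_ (∣⁅x⁆∣≡1 x) (∣⁅x⁆∣≡1 y) ⟩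
  2          <⟨ s≤s (s≤s (s≤s z≤n)) ⟩
  3          ∎)
  where open ≤-Reasoning
pair-nontrivial {x = x} {y} _ x≢y (inj₂ (inj₂ single)) =
  <-irrefl (≡-sym single) (subst (_< ∣ pair x y ∣) (∣⁅x⁆∣≡1 x) (p⊂q⇒∣p∣<∣q∣ ⁅x⁆⊂pair))
  where
  ⁅x⁆⊂pair : ⁅ x ⁆ ⊂ pair x y
  ⁅x⁆⊂pair = (λ a∈ → x∈p∪q⁺ (inj₁ a∈)) , y , y∈pair x y , x≢y⇒x∉⁅y⁆ (λ y≡x → x≢y (≡-sym y≡x))

prime⇒twins-equal : ∀ {n} (G : Graph n) → IsPrime G → ∀ {x y} → AreTwins G x y → x ≡ y
prime⇒twins-equal G (4≤n , onlyTrivial) {x} {y} twins with x ≟ y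
... | yes x≡y = x≡y
... | no  x≢y = ⊥-elim (pair-nontrivial 4≤n x≢y (onlyTrivial (pair x y) (twins⇒module G twins)))

-- M is b-homogeneous if all pairs of distinct vertices of M have adjacency b:
-- a clique is exactly a true-homogeneous set, and a stable set is
-- false-homogeneous.
IsHomogeneous : ∀ {n} → Graph n → Bool → Subset n → Set
IsHomogeneous G b M = ∀ x y → x ∈ M → y ∈ M → x ≢ y → adj G x y ≡ b

stable⇒homogeneous : ∀ {n} (G : Graph n) {M} → IsStable G M → IsHomogeneous G false M
stable⇒homogeneous G stable x y x∈ y∈ _ = stable x y x∈ y∈

homogeneous-module⇒twins : ∀ {n} (G : Graph n) {b M} → IsModule G M → IsHomogeneous G b M →
  ∀ {x y} → x ∈ M → y ∈ M → AreTwins G x y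
homogeneous-module⇒twins G {M = M} module′ hom {x} {y} x∈ y∈ v v≢x v≢y with v ∈? M
... | yes v∈ = trans (hom v x v∈ x∈ v≢x) (≡-sym (hom v y v∈ y∈ v≢y))
... | no  v∉ = module′ v v∉ x y x∈ y∈

data OldOrNew (n p : ℕ) : Fin (n + p) → Set where
  old : ∀ u → OldOrNew n p (u ↑ˡ p)
  new : ∀ j → OldOrNew n p (n ↑ʳ j)

oldOrNew : ∀ n p v → OldOrNew n p v
oldOrNew n p v with splitAt n v in eq
... | inj₁ u = subst (OldOrNew n p) (splitAt⁻¹-↑ˡ eq) (old u)
... | inj₂ j = subst (OldOrNew n p) (splitAt⁻¹-↑ʳ eq) (new j)

trace : ∀ {n p} → Graph (n + p) → Fin p → Fin n → Bool
trace {n} {p} H j u = adj H (n ↑ʳ j) (u ↑ˡ p)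

-- Old vertices see x, y alike because they are twins in G = H[old];
-- new vertices see them alike because the traces agree.
twins-lift : ∀ {n p} (G : Graph n) (H : Graph (n + p)) → IsExtension G H →
  ∀ {x y} → AreTwins G x y → (∀ j → trace H j x ≡ trace H j y) →
  AreTwins H (x ↑ˡ p) (y ↑ˡ p)
twins-lift {n} {p} G H ext {x} {y} twins sameTrace v = onPart (oldOrNew n p v)
  where
  onPart : ∀ {v} → OldOrNew n p v → v ≢ x ↑ˡ p → v ≢ y ↑ˡ p → adj H v (x ↑ˡ p) ≡ adj H v (y ↑ˡ p)
  onPart (new j) _ _ = sameTrace j
  onPart (old u) u≢x u≢y = begin
    adj H (u ↑ˡ p) (x ↑ˡ p) ≡⟨ ext u x ⟩
    adj G u x               ≡⟨ twins u (λ u≡x → u≢x (cong (_↑ˡ p) u≡x)) (λ u≡y → u≢y (cong (_↑ˡ p) u≡y)) ⟩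
    adj G u y               ≡⟨ ≡-sym (ext u y) ⟩
    adj H (u ↑ˡ p) (y ↑ˡ p) ∎
    where open ≡-Reasoning

homogeneous-module-≤2^ : ∀ {n p} (G : Graph n) (H : Graph (n + p)) → IsExtension G H → IsPrime H →
  ∀ {b M} → IsModule G M → IsHomogeneous G b M → ∣ M ∣ ≤ 2 ^ p
homogeneous-module-≤2^ {p = p} G H ext prime {M = M} module′ hom = separated-≤2^ p (trace H) M separates
  where
  separates : Separates (trace H) M
  separates x y x∈ y∈ sameTrace =
    ↑ˡ-injective p x y (prime⇒twins-equal H prime
      (twins-lift G H ext (homogeneous-module⇒twins G module′ hom x∈ y∈) sameTrace))

lemma1 : ∀ {n} (G : Graph n) (a w p : ℕ) →
    IsModStabilityNumber G a → IsModCliqueNumber G w → IsPrimeBound G p →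
    2 ≤ a ⊔ w → ⌈log₂ (a ⊔ w) ⌉ ≤ p
lemma1 G a w p ((Mα , moduleα , stableα , ∣Mα∣≡a) , _) ((Mω , moduleω , cliqueω , ∣Mω∣≡w) , _) ((H , ext , prime) , _) _ =
  begin
    ⌈log₂ (a ⊔ w) ⌉   ≤⟨ ⌈log₂⌉-mono-≤ (⊔-lub a≤2^p w≤2^p) ⟩
    ⌈log₂ (2 ^ p) ⌉   ≡⟨ ⌈log₂2^n⌉≡n p ⟩
    p                 ∎
  where
  open ≤-Reasoning
  a≤2^p : a ≤ 2 ^ p
  a≤2^p = subst (_≤ 2 ^ p) ∣Mα∣≡a (homogeneous-module-≤2^ G H ext prime moduleα (stable⇒homogeneous G stableα))
  w≤2^p : w ≤ 2 ^ p
  w≤2^p = subst (_≤ 2 ^ p) ∣Mω∣≡w (homogeneous-module-≤2^ G H ext prime moduleω cliqueω)
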